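{- Let $\mathbf A$ be a finite symmetric relation algebra with a normal representation such that $\mathbf A$ has all $1$-cycles and admits a Siggers behavior, and let $R\subseteq A_0^3$ be the set of allowed triples of $\mathbf A$. Then: (1) for all $a\in A_0$ we have $(a,a,a)\in R$; (2) for all $a,b\in A_0$ we have $(a,a,b)\in R$ or $(a,b,b)\in R$.
   Context: $\mathbf A=(A;\cup,\bar{\ },0,1,\mathrm{id},\breve{\ },\circ)$ is a relation algebra (Tarski's axioms), symmetric if $\breve a=a$ for all $a$; $A_0$ is its set of atoms. A triple $(x,y,z)\in A_0^3$ is allowed if $z\le x\circ y$. $\mathbf A$ has all $1$-cycles if $(a,a,a)$ is allowed for all $a\in A_0$. $\mathbf A$ admits a Siggers behavior if there is $s\colon A_0^6\to A_0$ preserving the allowed triples (componentwise), with $s(x_1,\dots,x_6)\in\{x_1,\dots,x_6\}$ and $s(x,x,y,y,z,z)=s(y,z,x,z,x,y)$. A normal representation is a representation $\mathfrak B$ (structure with binary relations $a^{\mathfrak B}$ such that $a\mapsto a^{\mathfrak B}$ is an isomorphism onto an algebra of binary relations with the set-theoretic operations) that is square ($1^{\mathfrak B}=B^2$), homogeneous, and fully universal (every atomic closed $\mathbf A$-network is satisfiable in it). -}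

module Defs where

open import Data.Nat using (ℕ)
open import Data.Fin using (Fin)
open import Data.Product using (Σ; _×_; _,_; proj₁; ∃)
open import Data.Sum using (_⊎_)
open import Data.Empty using (⊥)
open import Data.List using (List)
open import Data.List.Membership.Propositional using (_∈_)
open import Relation.Nullary using (¬_)
open import Relation.Binary.PropositionalEquality using (_≡_; _≢_)
open import Function.Bundles using (_⇔_)

record RelationAlgebra : Set₁ where
  infixr 6 _∪_
  infixr 7 _∘_
  infix 8 ‾_
  infix 9 _˘
  field
    Carrier : Set
    _∪_     : Carrier → Carrier → Carrier
    ‾_      : Carrier → Carrier
    𝟘 𝟙     : Carrier
    ident   : Carrier
    _˘      : Carrier → Carrier
    _∘_     : Carrier → Carrier → Carrier
    ∪-comm      : ∀ x y → x ∪ y ≡ y ∪ x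
    ∪-assoc     : ∀ x y z → x ∪ (y ∪ z) ≡ (x ∪ y) ∪ z
    huntington  : ∀ x y → ‾ (‾ x ∪ y) ∪ ‾ (‾ x ∪ ‾ y) ≡ x
    𝟙-def       : ∀ x → 𝟙 ≡ x ∪ ‾ x
    𝟘-def       : 𝟘 ≡ ‾ 𝟙
    ∘-assoc     : ∀ x y z → x ∘ (y ∘ z) ≡ (x ∘ y) ∘ z
    ∘-distribʳ  : ∀ x y z → (x ∪ y) ∘ z ≡ (x ∘ z) ∪ (y ∘ z)
    ∘-identityʳ : ∀ x → x ∘ ident ≡ x
    ˘-involutive : ∀ x → (x ˘) ˘ ≡ x
    ˘-distrib-∪ : ∀ x y → (x ∪ y) ˘ ≡ (x ˘) ∪ (y ˘)
    ˘-distrib-∘ : ∀ x y → (x ∘ y) ˘ ≡ (y ˘) ∘ (x ˘)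
    tarski      : ∀ x y → ((x ˘) ∘ ‾ (x ∘ y)) ∪ ‾ y ≡ ‾ y

  _≤_ : Carrier → Carrier → Set
  x ≤ y = x ∪ y ≡ y

  IsAtom : Carrier → Set
  IsAtom a = (a ≢ 𝟘) × (∀ x → x ≤ a → (x ≡ 𝟘) ⊎ (x ≡ a))

  Atom : Set
  Atom = Σ Carrier IsAtom

  Allowed : Atom → Atom → Atom → Set
  Allowed x y z = proj₁ z ≤ (proj₁ x ∘ proj₁ y)

open RelationAlgebra public

Finite : RelationAlgebra → Set
Finite A = Σ (List (Carrier A)) λ xs → ∀ x → x ∈ xs

Symmetric : RelationAlgebra → Set
Symmetric A = ∀ a → _˘ A a ≡ a

HasAll1Cycles : RelationAlgebra → Set
HasAll1Cycles A = ∀ (a : Atom A) → Allowed A a a a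

record SiggersBehaviour (A : RelationAlgebra) : Set where
  field
    s : Atom A → Atom A → Atom A → Atom A → Atom A → Atom A → Atom A
    preserves : ∀ x₁ x₂ x₃ x₄ x₅ x₆ y₁ y₂ y₃ y₄ y₅ y₆ z₁ z₂ z₃ z₄ z₅ z₆ →
      Allowed A x₁ y₁ z₁ → Allowed A x₂ y₂ z₂ → Allowed A x₃ y₃ z₃ →
      Allowed A x₄ y₄ z₄ → Allowed A x₅ y₅ z₅ → Allowed A x₆ y₆ z₆ →
      Allowed A (s x₁ x₂ x₃ x₄ x₅ x₆) (s y₁ y₂ y₃ y₄ y₅ y₆) (s z₁ z₂ z₃ z₄ z₅ z₆)
    conservative : ∀ x₁ x₂ x₃ x₄ x₅ x₆ →
      let r = proj₁ (s x₁ x₂ x₃ x₄ x₅ x₆) in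
      (r ≡ proj₁ x₁) ⊎ (r ≡ proj₁ x₂) ⊎ (r ≡ proj₁ x₃) ⊎
      (r ≡ proj₁ x₄) ⊎ (r ≡ proj₁ x₅) ⊎ (r ≡ proj₁ x₆)
    siggers : ∀ x y z → proj₁ (s x x y y z z) ≡ proj₁ (s y z x z x y)

record SquareRepresentation (A : RelationAlgebra) : Set₁ where
  field
    Dom : Set
    rel : Carrier A → Dom → Dom → Set
    rel-∪ : ∀ a b x y → rel (_∪_ A a b) x y ⇔ (rel a x y ⊎ rel b x y)
    rel-‾ : ∀ a x y → rel (‾_ A a) x y ⇔ (¬ rel a x y)
    rel-𝟘 : ∀ x y → rel (𝟘 A) x y ⇔ ⊥
    rel-𝟙 : ∀ x y → rel (𝟙 A) x y
    rel-id : ∀ x y → rel (ident A) x y ⇔ (x ≡ y)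
    rel-˘ : ∀ a x y → rel (_˘ A a) x y ⇔ rel a y x
    rel-∘ : ∀ a b x y → rel (_∘_ A a b) x y ⇔ ∃ λ z → rel a x z × rel b z y
    rel-injective : ∀ a b → (∀ x y → rel a x y ⇔ rel b x y) → a ≡ b

module _ {A : RelationAlgebra} (𝔅 : SquareRepresentation A) where
  open SquareRepresentation 𝔅

  record Automorphism : Set where
    field
      fun : Dom → Dom
      inv : Dom → Dom
      inv-left : ∀ x → inv (fun x) ≡ x
      inv-right : ∀ x → fun (inv x) ≡ x
      preserves : ∀ a x y → rel a x y ⇔ rel a (fun x) (fun y)

  -- homogeneity: every isomorphism between finite substructures (given by
  -- enumerations f, g : Fin n → Dom with f i ↦ g i) extends to an automorphism
  Homogeneous : Set
  Homogeneous = ∀ (n : ℕ) (f g : Fin n → Dom) →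
    (∀ a i j → rel a (f i) (f j) ⇔ rel a (g i) (g j)) →
    Σ Automorphism λ α → ∀ i → Automorphism.fun α (f i) ≡ g i

  AtomicClosedNetwork : ℕ → Set
  AtomicClosedNetwork n = Σ (Fin n → Fin n → Carrier A) λ N →
    (∀ i j → IsAtom A (N i j)) ×
    (∀ i → _≤_ A (N i i) (ident A)) ×
    (∀ i j → N i j ≡ _˘ A (N j i)) ×
    (∀ i j k → _≤_ A (N i k) (_∘_ A (N i j) (N j k)))

  Satisfiable : ∀ {n} → AtomicClosedNetwork n → Set
  Satisfiable {n} (N , _) = Σ (Fin n → Dom) λ h → ∀ i j → rel (N i j) (h i) (h j)

  FullyUniversal : Set
  FullyUniversal = ∀ n (N : AtomicClosedNetwork n) → Satisfiable N

record NormalRepresentation (A : RelationAlgebra) : Set₁ where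
  field
    rep : SquareRepresentation A
    homogeneous : Homogeneous rep
    fullyUniversal : FullyUniversal rep

{-# OPTIONS --safe #-}
-- Part (1) is the hypothesis that all 1-cycles are allowed. For (2), suppose
-- neither (a,a,b) nor (a,b,b) is allowed. With a square representation of a
-- symmetric algebra the identity is an atom e, and on {e,a,b} the triples
-- (c,c,c), (e,c,c), (c,e,c) are allowed while (e,e,b), (e,e,a), (a,b,a) are not.
-- By the Siggers identity, s(x,x,y,y,z,z) = s(y,z,x,z,x,y), so applying s to
-- the six triples (x,y,c), (x,z,c), ..., (z,y,c) yields a loop at it over c.
-- This forces s(b,b,b,b,e,e) = s(b,b,e,e,b,b) = b and s(e,e,a,a,a,a) = a;
-- preservation of (e,b,b) and (a,e,a) transports the first two values to
-- s(e,e,e,e,a,a) = s(e,e,a,a,e,e) = e, and then the columns (e,e,e), (e,a,a),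
-- (a,e,a) are mapped to the forbidden triple (e,e,a).
module Submission where

open import Defs
  using ( RelationAlgebra; Atom; Allowed; Symmetric; Finite; HasAll1Cycles
        ; SiggersBehaviour; SquareRepresentation; NormalRepresentation )
open import Data.Product using (_×_; _,_; proj₁; proj₂; ∃₂)
open import Data.Sum using (_⊎_; inj₁; inj₂; [_,_])
open import Data.Empty using (⊥; ⊥-elim)
open import Relation.Nullary using (¬_; Dec; yes; no)
open import Relation.Binary.PropositionalEquality
  using (_≡_; refl; sym; cong₂; subst; module ≡-Reasoning)
open import Function.Bundles using (mk⇔; Equivalence)
open Equivalence using (to; from)

module RelationAlgebraProperties (A : RelationAlgebra) where
  open RelationAlgebra A hiding (Atom; Allowed)

  atom-≤⇒≡ : ∀ {x y} → IsAtom x → IsAtom y → x ≤ y → x ≡ y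
  atom-≤⇒≡ x-atom y-atom x≤y with proj₂ y-atom _ x≤y
  ... | inj₁ x≡𝟘 = ⊥-elim (proj₁ x-atom x≡𝟘)
  ... | inj₂ x≡y = x≡y

  Allowed-cong : ∀ {x y z x′ y′ z′} → x ≡ x′ → y ≡ y′ → z ≡ z′ →
    z ≤ (x ∘ y) → z′ ≤ (x′ ∘ y′)
  Allowed-cong refl refl refl z≤x∘y = z≤x∘y

module SquareRepresentationProperties {A : RelationAlgebra} (𝔅 : SquareRepresentation A) where
  open RelationAlgebra A hiding (Atom; Allowed)
  open SquareRepresentation 𝔅

  _∩_ : Carrier → Carrier → Carrier
  c ∩ d = ‾ (‾ c ∪ ‾ d)

  ¬rel-𝟘 : ∀ {x y} → ¬ rel 𝟘 x y
  ¬rel-𝟘 {x} {y} = to (rel-𝟘 x y)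

  rel? : ∀ c x y → Dec (rel c x y)
  rel? c x y
    with to (rel-∪ c (‾ c) x y) (subst (λ u → rel u x y) (𝟙-def c) (rel-𝟙 x y))
  ... | inj₁ cxy = yes cxy
  ... | inj₂ ‾cxy = no (to (rel-‾ c x y) ‾cxy)

  ≤⇒⊆ : ∀ {c d x y} → c ≤ d → rel c x y → rel d x y
  ≤⇒⊆ {c} {d} {x} {y} c≤d cxy =
    subst (λ u → rel u x y) c≤d (from (rel-∪ c d x y) (inj₁ cxy))

  ⊆⇒≤ : ∀ {c d} → (∀ {x y} → rel c x y → rel d x y) → c ≤ d
  ⊆⇒≤ {c} {d} c⊆d = rel-injective (c ∪ d) d λ x y →
    mk⇔ (λ c∪dxy → [ c⊆d , (λ dxy → dxy) ] (to (rel-∪ c d x y) c∪dxy))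
        (λ dxy → from (rel-∪ c d x y) (inj₂ dxy))

  ≤-refl : ∀ {c} → c ≤ c
  ≤-refl = ⊆⇒≤ (λ cxy → cxy)

  empty⇒≡𝟘 : ∀ {c} → (∀ {x y} → ¬ rel c x y) → c ≡ 𝟘
  empty⇒≡𝟘 {c} c-empty = rel-injective c 𝟘 λ x y →
    mk⇔ (λ cxy → ⊥-elim (c-empty cxy)) (λ 𝟘xy → ⊥-elim (¬rel-𝟘 𝟘xy))

  rel-∩⁺ : ∀ {c d x y} → rel c x y → rel d x y → rel (c ∩ d) x y
  rel-∩⁺ {c} {d} {x} {y} cxy dxy = from (rel-‾ _ x y) λ ‾c∪‾dxy →
    [ (λ ‾cxy → to (rel-‾ c x y) ‾cxy cxy) , (λ ‾dxy → to (rel-‾ d x y) ‾dxy dxy) ]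
      (to (rel-∪ (‾ c) (‾ d) x y) ‾c∪‾dxy)

  rel-∩⁻ : ∀ {c d x y} → rel (c ∩ d) x y → rel c x y × rel d x y
  rel-∩⁻ {c} {d} {x} {y} c∩dxy = stable c inj₁ , stable d inj₂
    where
    stable : ∀ u → (rel (‾ u) x y → rel (‾ c) x y ⊎ rel (‾ d) x y) → rel u x y
    stable u inject with rel? u x y
    ... | yes uxy = uxy
    ... | no ¬uxy = ⊥-elim (to (rel-‾ _ x y) c∩dxy
                     (from (rel-∪ (‾ c) (‾ d) x y) (inject (from (rel-‾ u x y) ¬uxy))))

  rel-∘⁺ : ∀ {c d x y z} → rel c x z → rel d z y → rel (c ∘ d) x y
  rel-∘⁺ {c} {d} {x} {y} {z} cxz dzy = from (rel-∘ c d x y) (z , cxz , dzy)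

  atom-inhabited : ∀ {c} → IsAtom c → ¬ ¬ ∃₂ (rel c)
  atom-inhabited c-atom c-empty = proj₁ c-atom (empty⇒≡𝟘 λ cxy → c-empty (_ , _ , cxy))

  atom-∩ : ∀ {z} d → IsAtom z → z ∩ d ≡ 𝟘 ⊎ z ∩ d ≡ z
  atom-∩ d z-atom = proj₂ z-atom _ (⊆⇒≤ λ z∩dxy → proj₁ (rel-∩⁻ z∩dxy))

  ∩≡⇒≤ : ∀ {z d} → z ∩ d ≡ z → z ≤ d
  ∩≡⇒≤ {z} {d} z∩d≡z = ⊆⇒≤ λ {x} {y} zxy →
    proj₂ (rel-∩⁻ (subst (λ u → rel u x y) (sym z∩d≡z) zxy))

  atom-≤-of-overlap : ∀ {z d x y} → IsAtom z → rel z x y → rel d x y → z ≤ d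
  atom-≤-of-overlap {z} {d} {x} {y} z-atom zxy dxy with atom-∩ d z-atom
  ... | inj₁ z∩d≡𝟘 =
    ⊥-elim (¬rel-𝟘 (subst (λ u → rel u x y) z∩d≡𝟘 (rel-∩⁺ zxy dxy)))
  ... | inj₂ z∩d≡z = ∩≡⇒≤ z∩d≡z

  atom-≤? : ∀ {z} → IsAtom z → ∀ d → Dec (z ≤ d)
  atom-≤? {z} z-atom d with atom-∩ d z-atom
  ... | inj₂ z∩d≡z = yes (∩≡⇒≤ z∩d≡z)
  ... | inj₁ z∩d≡𝟘 = no λ z≤d → proj₁ z-atom (empty⇒≡𝟘 λ {x} {y} zxy →
          ¬rel-𝟘 (subst (λ u → rel u x y) z∩d≡𝟘 (rel-∩⁺ zxy (≤⇒⊆ z≤d zxy))))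

  Allowed-of-triangle : ∀ {x y z p q r} → IsAtom z →
    rel x p q → rel y q r → rel z p r → z ≤ (x ∘ y)
  Allowed-of-triangle z-atom xpq yqr zpr = atom-≤-of-overlap z-atom zpr (rel-∘⁺ xpq yqr)

module SymmetricProperties {A : RelationAlgebra} (symmetric : Symmetric A) where
  open RelationAlgebra A hiding (Atom; Allowed)
  open ≡-Reasoning

  ∘-identityˡ : ∀ c → ident ∘ c ≡ c
  ∘-identityˡ c = begin
    ident ∘ c           ≡⟨ sym (symmetric (ident ∘ c)) ⟩
    (ident ∘ c) ˘       ≡⟨ ˘-distrib-∘ ident c ⟩
    (c ˘) ∘ (ident ˘)   ≡⟨ cong₂ _∘_ (symmetric c) (symmetric ident) ⟩
    c ∘ ident           ≡⟨ ∘-identityʳ c ⟩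
    c                   ∎

module SymmetricRepresentationProperties {A : RelationAlgebra} (symmetric : Symmetric A)
    (𝔅 : SquareRepresentation A) where
  open RelationAlgebra A hiding (Atom; Allowed)
  open SquareRepresentation 𝔅
  open SquareRepresentationProperties 𝔅
  open SymmetricProperties {A} symmetric

  rel-sym : ∀ {c x y} → rel c x y → rel c y x
  rel-sym {c} {x} {y} cxy = subst (λ u → rel u y x) (symmetric c) (from (rel-˘ c y x) cxy)

  -- w ∘ 𝟙 relates p to x, so by symmetry x to p, through a w-edge leaving x,
  -- which is a loop since w ≤ ident.
  subidentity-total : ∀ {w p x} → w ≤ ident → rel w p p → rel w x x
  subidentity-total {w} {p} {x} w≤ident wpp
    with to (rel-∘ w 𝟙 x p) (rel-sym (rel-∘⁺ wpp (rel-𝟙 p x)))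
  ... | z , wxz , _ with to (rel-id x z) (≤⇒⊆ w≤ident wxz)
  ... | refl = wxz

  ident-atom : Dom → IsAtom ident
  ident-atom p = ident≢𝟘 , below-ident
    where
    ident≢𝟘 : ¬ ident ≡ 𝟘
    ident≢𝟘 ident≡𝟘 = ¬rel-𝟘 (subst (λ u → rel u p p) ident≡𝟘 (from (rel-id p p) refl))

    below-ident : ∀ w → w ≤ ident → w ≡ 𝟘 ⊎ w ≡ ident
    below-ident w w≤ident with rel? w p p
    ... | yes wpp = inj₂ (rel-injective w ident λ x y → mk⇔ (≤⇒⊆ w≤ident) ident⊆w)
      where
      ident⊆w : ∀ {x y} → rel ident x y → rel w x y
      ident⊆w {x} {y} identxy with to (rel-id x y) identxy
      ... | refl = subidentity-total w≤ident wpp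
    ... | no ¬wpp = inj₁ (empty⇒≡𝟘 w-empty)
      where
      w-empty : ∀ {x y} → ¬ rel w x y
      w-empty {x} {y} wxy with to (rel-id x y) (≤⇒⊆ w≤ident wxy)
      ... | refl = ¬wpp (subidentity-total w≤ident wxy)

  ≤-∘-identityʳ : ∀ {c} → c ≤ (c ∘ ident)
  ≤-∘-identityʳ {c} = subst (c ≤_) (sym (∘-identityʳ c)) ≤-refl

  ≤-∘-identityˡ : ∀ {c} → c ≤ (ident ∘ c)
  ≤-∘-identityˡ {c} = subst (c ≤_) (sym (∘-identityˡ c)) ≤-refl

  ident-≤-∘-self : ∀ {c p q} → rel c p q → ident ≤ (c ∘ c)
  ident-≤-∘-self {p = p} cpq =
    Allowed-of-triangle (ident-atom p) cpq (rel-sym cpq) (from (rel-id p p) refl)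

  Allowed-rotate : ∀ {x y z p r} → IsAtom y → rel z p r → z ≤ (x ∘ y) → y ≤ (x ∘ z)
  Allowed-rotate {x} {y} {z} {p} {r} y-atom zpr z≤x∘y
    with to (rel-∘ x y p r) (≤⇒⊆ z≤x∘y zpr)
  ... | q , xpq , yqr = Allowed-of-triangle y-atom (rel-sym xpq) zpr yqr

module SiggersProperties {A : RelationAlgebra} (S : SiggersBehaviour A) where
  open RelationAlgebra A using (Carrier)
  open SiggersBehaviour S
  open RelationAlgebraProperties A

  s-closed : ∀ (P : Carrier → Set) {x₁ x₂ x₃ x₄ x₅ x₆} →
    P (proj₁ x₁) → P (proj₁ x₂) → P (proj₁ x₃) → P (proj₁ x₄) → P (proj₁ x₅) → P (proj₁ x₆) →
    P (proj₁ (s x₁ x₂ x₃ x₄ x₅ x₆))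
  s-closed P {x₁} {x₂} {x₃} {x₄} {x₅} {x₆} p₁ p₂ p₃ p₄ p₅ p₆ =
    [ via p₁ , [ via p₂ , [ via p₃ , [ via p₄ , [ via p₅ , via p₆ ] ] ] ] ]
      (conservative x₁ x₂ x₃ x₄ x₅ x₆)
    where
    via : ∀ {c} → P c → proj₁ (s x₁ x₂ x₃ x₄ x₅ x₆) ≡ c →
      P (proj₁ (s x₁ x₂ x₃ x₄ x₅ x₆))
    via pc eq = subst P (sym eq) pc

  s-idempotent : ∀ x → proj₁ (s x x x x x x) ≡ proj₁ x
  s-idempotent x = s-closed (_≡ proj₁ x) refl refl refl refl refl refl

  s-diagonal-loop : ∀ x y z c →
    Allowed A x y c → Allowed A x z c → Allowed A y x c →
    Allowed A y z c → Allowed A z x c → Allowed A z y c →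
    Allowed A (s x x y y z z) (s x x y y z z) c
  s-diagonal-loop x y z c xyc xzc yxc yzc zxc zyc =
    Allowed-cong refl (sym (siggers x y z)) (s-idempotent c)
      (preserves x x y y z z y z x z x y c c c c c c xyc xzc yxc yzc zxc zyc)

module SiggersObstruction {A : RelationAlgebra} (S : SiggersBehaviour A) (e a b : Atom A)
    (bbb : Allowed A b b b) (beb : Allowed A b e b) (ebb : Allowed A e b b)
    (aaa : Allowed A a a a) (aea : Allowed A a e a) (eaa : Allowed A e a a)
    (eee : Allowed A e e e)
    (¬eeb : ¬ Allowed A e e b) (¬eea : ¬ Allowed A e e a)
    (¬abb : ¬ Allowed A a b b) (¬aba : ¬ Allowed A a b a) where
  open RelationAlgebra A hiding (Atom; Allowed)
  open SiggersBehaviour S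
  open RelationAlgebraProperties A
  open SiggersProperties S

  _∈⟨_,_⟩ : Carrier → Carrier → Carrier → Set
  c ∈⟨ u , v ⟩ = c ≡ u ⊎ c ≡ v

  left : ∀ {u v} → u ∈⟨ u , v ⟩
  left = inj₁ refl

  right : ∀ {u v} → v ∈⟨ u , v ⟩
  right = inj₂ refl

  left-unless-right : ∀ {c u v} → c ∈⟨ u , v ⟩ → ¬ c ≡ v → c ≡ u
  left-unless-right (inj₁ c≡u) _   = c≡u
  left-unless-right (inj₂ c≡v) c≢v = ⊥-elim (c≢v c≡v)

  no-a-b-edge : ∀ {x y z} → x ≡ proj₁ a → y ≡ proj₁ b → z ∈⟨ proj₁ b , proj₁ a ⟩ →
    ¬ z ≤ (x ∘ y)
  no-a-b-edge refl refl (inj₁ refl) = ¬abb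
  no-a-b-edge refl refl (inj₂ refl) = ¬aba

  s-bbbbee : proj₁ (s b b b b e e) ≡ proj₁ b
  s-bbbbee = left-unless-right
    (s-closed (_∈⟨ proj₁ b , proj₁ e ⟩) left left left left right right)
    λ t≡e → ¬eeb (Allowed-cong t≡e t≡e refl
      (s-diagonal-loop b b e b bbb beb bbb beb ebb ebb))

  s-bbeebb : proj₁ (s b b e e b b) ≡ proj₁ b
  s-bbeebb = left-unless-right
    (s-closed (_∈⟨ proj₁ b , proj₁ e ⟩) left left right right left left)
    λ t≡e → ¬eeb (Allowed-cong t≡e t≡e refl
      (s-diagonal-loop b e b b beb bbb ebb ebb bbb beb))

  s-eeeeaa : proj₁ (s e e e e a a) ≡ proj₁ e
  s-eeeeaa = left-unless-right
    (s-closed (_∈⟨ proj₁ e , proj₁ a ⟩) left left left left right right)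
    λ t≡a → no-a-b-edge t≡a s-bbbbee
      (s-closed (_∈⟨ proj₁ b , proj₁ a ⟩) left left left left right right)
      (preserves e e e e a a b b b b e e b b b b a a ebb ebb ebb ebb aea aea)

  s-eeaaee : proj₁ (s e e a a e e) ≡ proj₁ e
  s-eeaaee = left-unless-right
    (s-closed (_∈⟨ proj₁ e , proj₁ a ⟩) left left right right left left)
    λ t≡a → no-a-b-edge t≡a s-bbeebb
      (s-closed (_∈⟨ proj₁ b , proj₁ a ⟩) left left right right left left)
      (preserves e e a a e e b b e e b b b b a a b b ebb ebb aea aea ebb ebb)

  s-eeaaaa : proj₁ (s e e a a a a) ≡ proj₁ a
  s-eeaaaa = left-unless-right
    (s-closed (_∈⟨ proj₁ a , proj₁ e ⟩) right right left left left left)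
    λ t≡e → ¬eea (Allowed-cong t≡e t≡e refl
      (s-diagonal-loop e a a a eaa eaa aea aaa aea aaa))

  impossible : ⊥
  impossible = ¬eea (Allowed-cong s-eeeeaa s-eeaaee s-eeaaaa
    (preserves e e e e a a e e a a e e e e a a a a eee eee eaa eaa aea aea))

module _ {A : RelationAlgebra} (symmetric : Symmetric A) (𝔅 : SquareRepresentation A)
    (all-1-cycles : HasAll1Cycles A) (S : SiggersBehaviour A) where
  open RelationAlgebra A hiding (Atom; Allowed)
  open SquareRepresentation 𝔅
  open SquareRepresentationProperties 𝔅
  open SymmetricRepresentationProperties symmetric 𝔅
  open RelationAlgebraProperties A

  neither-aab-nor-abb⇒⊥ : ∀ (a b : Atom A) {p q} → rel (proj₁ a) p q →
    ¬ Allowed A a a b → ¬ Allowed A a b b → ⊥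
  neither-aab-nor-abb⇒⊥ a b {p} apq ¬aab ¬abb =
    SiggersObstruction.impossible S e a b
      (all-1-cycles b) ≤-∘-identityʳ ≤-∘-identityˡ
      (all-1-cycles a) ≤-∘-identityʳ ≤-∘-identityˡ
      (all-1-cycles e) ¬eeb ¬eea ¬abb ¬aba
    where
    e : Atom A
    e = ident , ident-atom p

    ≡ident : ∀ {c} → IsAtom c → c ≤ (ident ∘ ident) → c ≡ ident
    ≡ident {c} c-atom c≤ident∘ident =
      atom-≤⇒≡ c-atom (ident-atom p) (subst (c ≤_) (∘-identityʳ ident) c≤ident∘ident)

    ¬eeb : ¬ Allowed A e e b
    ¬eeb eeb = ¬aab
      (subst (_≤ (proj₁ a ∘ proj₁ a)) (sym (≡ident (proj₂ b) eeb)) (ident-≤-∘-self apq))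

    ¬eea : ¬ Allowed A e e a
    ¬eea eea = ¬abb
      (subst (λ c → proj₁ b ≤ (c ∘ proj₁ b)) (sym (≡ident (proj₂ a) eea)) ≤-∘-identityˡ)

    ¬aba : ¬ Allowed A a b a
    ¬aba aba = ¬aab (Allowed-rotate (proj₂ b) apq aba)

  Allowed-aab-or-abb : (a b : Atom A) → Allowed A a a b ⊎ Allowed A a b b
  Allowed-aab-or-abb a b
    with atom-≤? (proj₂ b) (proj₁ a ∘ proj₁ a) | atom-≤? (proj₂ b) (proj₁ a ∘ proj₁ b)
  ... | yes aab | _       = inj₁ aab
  ... | no _    | yes abb = inj₂ abb
  ... | no ¬aab | no ¬abb =
    ⊥-elim (atom-inhabited (proj₂ a) λ (_ , _ , apq) →
      neither-aab-nor-abb⇒⊥ a b apq ¬aab ¬abb)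

lemmaB1 : (A : RelationAlgebra) → Finite A → Symmetric A →
    NormalRepresentation A → HasAll1Cycles A → SiggersBehaviour A →
    (∀ (a : Atom A) → Allowed A a a a) ×
    (∀ (a b : Atom A) → Allowed A a a b ⊎ Allowed A a b b)
lemmaB1 A _ symmetric normal all-1-cycles S =
  all-1-cycles , Allowed-aab-or-abb symmetric (NormalRepresentation.rep normal) all-1-cycles S
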